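{- Let $G$ be a graph and let $(G_1,G_2)$ be a decomposition of $G$ which is a component decomposition, an anticomponent decomposition, a cutset decomposition, a module decomposition, a $\mathcal{C}'$-neighborhood decomposition, a $\mathcal{C}'$-antineighborhood decomposition (for some class $\mathcal{C}'$), or an amalgam decomposition. Then $(G_1,G_2)$ is valid: whenever $G_1$ admits a CS-Separator of size $f_1$ and $G_2$ admits a CS-Separator of size $f_2$, $G$ admits a CS-Separator of size $f_1+f_2$.
   Context: Graphs are finite and simple. A cut of $G$ is a partition $(W,W')$ of $V(G)$; it separates disjoint $K,S$ if $K\subseteq W$, $S\subseteq W'$. A CS-Separator of $G$ is a finite family (repetitions allowed) of cuts such that for every clique $K$ and stable set $S$ of $G$ with $K\cap S=\emptyset$ some cut of the family separates them; its size is the number of cuts. For $A,B\subseteq V(G)$, $A$ is complete (resp. anticomplete) to $B$ if every (resp. no) vertex of $A$ is adjacent to every vertex of $B$. Decompositions: (i) component decomposition: $(G[A],G[B])$ where $(A,B)$ is a partition of $V(G)$ into nonempty sets with $A$ anticomplete to $B$; (ii) anticomponent decomposition: same with $A$ complete to $B$; (iii) cutset decomposition: $(G[A\cup C],G[B\cup C])$ where $(A,C,B)$ partitions $V(G)$, $A,B$ nonempty, $A$ anticomplete to $B$; (iv) module decomposition: a module is $M\subseteq V(G)$ such that every vertex outside $M$ is complete or anticomplete to $M$; it is nontrivial if $|M|\ge2$ and $M\ne V(G)$; for a nontrivial module $M$ and $m\in M$, the decomposition is $(G[M],G[\{m\}\cup(V(G)\setminus M)])$; (v) $\mathcal{C}'$-neighborhood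 decomposition at $v$: $(G\setminus v,G[N(v)])$ where $G[N(v)]\in\mathcal{C}'$; (vi) $\mathcal{C}'$-antineighborhood decomposition at $v$: $(G\setminus v,G\setminus N[v])$ where $G\setminus N[v]\in\mathcal{C}'$ and $N[v]=N(v)\cup\{v\}$; (vii) amalgam decomposition: given a partition of $V(G)$ into $B_1,A_1,C,A_2,B_2$ with $A_1,A_2$ nonempty, $|A_1\cup B_1|\ge2$, $|A_2\cup B_2|\ge2$, $C$ a clique, $C$ complete to $A_1\cup A_2$, $A_1$ complete to $A_2$, $B_1$ anticomplete to $A_2\cup B_2$, and $B_2$ anticomplete to $A_1\cup B_1$, and given $a_1\in A_1$, $a_2\in A_2$, the decomposition is $(G[B_1\cup A_1\cup C\cup\{a_2\}],G[\{a_1\}\cup C\cup A_2\cup B_2])$. -}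

module Defs where

open import Data.Bool using (Bool; true; false; not; _∧_; _∨_)
open import Data.Bool.Properties using () renaming (_≟_ to _≟ᵇ_)
open import Data.Nat using (ℕ; _+_)
open import Data.List using (List; []; _∷_; length)
open import Data.List.Membership.Propositional using (_∈_)
open import Data.List.Relation.Unary.Any using (Any; here; there)
open import Data.Product using (Σ; _×_; _,_; ∃; ∃-syntax; proj₁; proj₂)
open import Data.Product.Properties using (≡-dec)
open import Data.Sum using (_⊎_)
open import Relation.Nullary using (¬_; yes; no)
open import Relation.Nullary.Decidable using (⌊_⌋)
open import Relation.Binary.Definitions using (DecidableEquality)
open import Relation.Binary.PropositionalEquality
  using (_≡_; _≢_; refl; sym; trans; cong; subst)
open import Axiom.UniquenessOfIdentityProofs using (module Decidable⇒UIP)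

record Graph : Set₁ where
  field
    V                 : Set
    _≟_               : DecidableEquality V
    adj               : V → V → Bool
    adj-sym           : ∀ u v → adj u v ≡ adj v u
    adj-irrefl        : ∀ v → adj v v ≡ false
    vertices          : List V
    vertices-complete : ∀ v → v ∈ vertices

open Graph public

Subset : Set → Set
Subset V = V → Bool

_∈ˢ_ : {V : Set} → V → Subset V → Set
v ∈ˢ X = X v ≡ true

private
  bool-uip : ∀ {a b : Bool} (p q : a ≡ b) → p ≡ q
  bool-uip = Decidable⇒UIP.≡-irrelevant _≟ᵇ_

module _ {V : Set} (X : Subset V) where
  private
    Sub : Set
    Sub = Σ V (λ v → X v ≡ true)

  mutual
    enumSub : List V → List Sub
    enumSub []       = []
    enumSub (v ∷ vs) = step v (X v) refl vs

    step : (v : V) (b : Bool) → X v ≡ b → List V → List Sub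
    step v true  eq vs = (v , eq) ∷ enumSub vs
    step v false eq vs = enumSub vs

  enumSub-complete : ∀ vs v (p : X v ≡ true) → v ∈ vs → (v , p) ∈ enumSub vs
  enumSub-complete (w ∷ vs) v p m = go (X w) refl m
    where
    go : (b : Bool) (eq : X w ≡ b) → v ∈ (w ∷ vs) → (v , p) ∈ step w b eq vs
    go true  eq (here refl) = here (cong (v ,_) (bool-uip p eq))
    go false eq (here refl) with () ← trans (sym eq) p
    go true  eq (there m)   = there (enumSub-complete vs v p m)
    go false eq (there m)   = enumSub-complete vs v p m

infixl 40 _[_]

_[_] : (G : Graph) → Subset (V G) → Graph
G [ X ] = record
  { V                 = Σ (V G) (λ v → X v ≡ true)
  ; _≟_               = ≡-dec (_≟_ G) (λ p q → yes (bool-uip p q))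
  ; adj               = λ u w → adj G (proj₁ u) (proj₁ w)
  ; adj-sym           = λ u w → adj-sym G (proj₁ u) (proj₁ w)
  ; adj-irrefl        = λ u → adj-irrefl G (proj₁ u)
  ; vertices          = enumSub X (vertices G)
  ; vertices-complete = λ u → enumSub-complete X (vertices G) (proj₁ u) (proj₂ u)
                                 (vertices-complete G (proj₁ u))
  }

module _ (G : Graph) where

  IsClique : Subset (V G) → Set
  IsClique K = ∀ u v → u ∈ˢ K → v ∈ˢ K → u ≢ v → adj G u v ≡ true

  IsStable : Subset (V G) → Set
  IsStable S = ∀ u v → u ∈ˢ S → v ∈ˢ S → adj G u v ≡ false

  Disjoint : Subset (V G) → Subset (V G) → Set
  Disjoint K S = ∀ v → v ∈ˢ K → ¬ (v ∈ˢ S)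

  -- A cut (W , W') of V(G) is encoded by the characteristic function of W
  -- (W' is its complement).
  Cut : Set
  Cut = V G → Bool

  Separates : Cut → Subset (V G) → Subset (V G) → Set
  Separates c K S = (∀ v → v ∈ˢ K → c v ≡ true) × (∀ v → v ∈ˢ S → c v ≡ false)

  -- a finite family of cuts (repetitions allowed) is a list of cuts
  IsCSSeparator : List Cut → Set
  IsCSSeparator cs =
    ∀ K S → IsClique K → IsStable S → Disjoint K S → Any (λ c → Separates c K S) cs

  HasCSSeparatorOfSize : ℕ → Set
  HasCSSeparatorOfSize f = Σ (List Cut) λ cs → length cs ≡ f × IsCSSeparator cs

Valid : Graph → Graph → Graph → Set
Valid G G₁ G₂ = ∀ f₁ f₂ → HasCSSeparatorOfSize G₁ f₁ → HasCSSeparatorOfSize G₂ f₂ →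
                HasCSSeparatorOfSize G (f₁ + f₂)

module _ (G : Graph) where

  Nonempty : Subset (V G) → Set
  Nonempty X = ∃[ v ] v ∈ˢ X

  AtLeastTwo : Subset (V G) → Set
  AtLeastTwo X = ∃[ u ] ∃[ v ] (u ∈ˢ X × v ∈ˢ X × u ≢ v)

  Complete : Subset (V G) → Subset (V G) → Set
  Complete A B = ∀ u v → u ∈ˢ A → v ∈ˢ B → adj G u v ≡ true

  Anticomplete : Subset (V G) → Subset (V G) → Set
  Anticomplete A B = ∀ u v → u ∈ˢ A → v ∈ˢ B → adj G u v ≡ false

  IsModule : Subset (V G) → Set
  IsModule M = ∀ x → M x ≡ false →
    (∀ y → y ∈ˢ M → adj G x y ≡ true) ⊎ (∀ y → y ∈ˢ M → adj G x y ≡ false)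

  Nontrivial : Subset (V G) → Set
  Nontrivial M = AtLeastTwo M × (∃[ x ] M x ≡ false)

  ≡ᵛ : V G → V G → Bool
  ≡ᵛ u v = ⌊ _≟_ G u v ⌋

  N : V G → Subset (V G)
  N v = adj G v

  N[_] : V G → Subset (V G)
  N[ v ] = λ w → adj G v w ∨ ≡ᵛ v w

  deleteV : V G → Subset (V G)
  deleteV v = λ w → not (≡ᵛ v w)

-- labels of the five parts of an amalgam partition
data Part : Set where
  pB₁ pA₁ pC pA₂ pB₂ : Part

isB₁ isA₁ isC isA₂ isB₂ : Part → Bool
isB₁ pB₁ = true
isB₁ _   = false
isA₁ pA₁ = true
isA₁ _   = false
isC  pC  = true
isC  _   = false
isA₂ pA₂ = true
isA₂ _   = false
isB₂ pB₂ = true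
isB₂ _   = false

module _ (G : Graph) (lab : V G → Part) where
  part : (Part → Bool) → Subset (V G)
  part P v = P (lab v)

-- A cutset partition (A , C , B) is encoded by a labelling
data Part3 : Set where
  qA qC qB : Part3

isQ : Part3 → Part3 → Bool
isQ qA qA = true
isQ qC qC = true
isQ qB qB = true
isQ _  _  = false

record IsAmalgam (G : Graph) (lab : V G → Part) : Set where
  field
    A₁-nonempty : Nonempty G (part G lab isA₁)
    A₂-nonempty : Nonempty G (part G lab isA₂)
    side₁-two   : AtLeastTwo G (λ v → isA₁ (lab v) ∨ isB₁ (lab v))
    side₂-two   : AtLeastTwo G (λ v → isA₂ (lab v) ∨ isB₂ (lab v))
    C-clique    : IsClique G (part G lab isC)
    C-A         : Complete G (part G lab isC) (λ v → isA₁ (lab v) ∨ isA₂ (lab v))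
    A₁-A₂       : Complete G (part G lab isA₁) (part G lab isA₂)
    B₁-anti     : Anticomplete G (part G lab isB₁) (λ v → isA₂ (lab v) ∨ isB₂ (lab v))
    B₂-anti     : Anticomplete G (part G lab isB₂) (λ v → isA₁ (lab v) ∨ isB₁ (lab v))

data Decomposition (G : Graph) : Set₁ where
  component     : (A : Subset (V G)) → Nonempty G A → Nonempty G (λ v → not (A v)) →
                  Anticomplete G A (λ v → not (A v)) → Decomposition G
  anticomponent : (A : Subset (V G)) → Nonempty G A → Nonempty G (λ v → not (A v)) →
                  Complete G A (λ v → not (A v)) → Decomposition G
  cutset        : (lab : V G → Part3) → Nonempty G (λ v → isQ qA (lab v)) →
                  Nonempty G (λ v → isQ qB (lab v)) →
                  Anticomplete G (λ v → isQ qA (lab v)) (λ v → isQ qB (lab v)) →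
                  Decomposition G
  module-dec    : (M : Subset (V G)) → IsModule G M → Nontrivial G M →
                  (m : V G) → m ∈ˢ M → Decomposition G
  nbhd          : (C′ : Graph → Set) (v : V G) → C′ (G [ N G v ]) → Decomposition G
  antinbhd      : (C′ : Graph → Set) (v : V G) →
                  C′ (G [ (λ w → not (N[_] G v w)) ]) → Decomposition G
  amalgam       : (lab : V G → Part) → IsAmalgam G lab →
                  (a₁ a₂ : V G) → lab a₁ ≡ pA₁ → lab a₂ ≡ pA₂ → Decomposition G

dec₁ dec₂ : (G : Graph) → Decomposition G → Graph
dec₁ G (component A _ _ _)        = G [ A ]
dec₁ G (anticomponent A _ _ _)    = G [ A ]
dec₁ G (cutset lab _ _ _)         = G [ (λ v → not (isQ qB (lab v))) ]
dec₁ G (module-dec M _ _ m _)     = G [ M ]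
dec₁ G (nbhd _ v _)               = G [ deleteV G v ]
dec₁ G (antinbhd _ v _)           = G [ deleteV G v ]
dec₁ G (amalgam lab _ a₁ a₂ _ _)  =
  G [ (λ v → isB₁ (lab v) ∨ isA₁ (lab v) ∨ isC (lab v) ∨ ≡ᵛ G a₂ v) ]
dec₂ G (component A _ _ _)        = G [ (λ v → not (A v)) ]
dec₂ G (anticomponent A _ _ _)    = G [ (λ v → not (A v)) ]
dec₂ G (cutset lab _ _ _)         = G [ (λ v → not (isQ qA (lab v))) ]
dec₂ G (module-dec M _ _ m _)     = G [ (λ v → ≡ᵛ G m v ∨ not (M v)) ]
dec₂ G (nbhd _ v _)               = G [ N G v ]
dec₂ G (antinbhd _ v _)           = G [ (λ w → not (N[_] G v w)) ]
dec₂ G (amalgam lab _ a₁ a₂ _ _)  =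
  G [ (λ v → ≡ᵛ G a₁ v ∨ isC (lab v) ∨ isA₂ (lab v) ∨ isB₂ (lab v)) ]

module Submission where

-- A folding of G onto G [ X ] sends
-- every vertex of G either to a vertex of X or to a fixed side (true/false) of
-- a cut; it turns a cut c of G [ X ] into the cut of G read through the fold.
-- If a clique K and a stable set S of G fold onto a clique and a stable set of
-- G [ X ] that are disjoint, and the fixed sides agree with K (true) and S
-- (false), then any cut separating the images separates K from S (transfer).
-- Hence, if every pair (K , S) transfers along a folding onto G₁ or along one
-- onto G₂, concatenating the two extended separators gives the separator of
-- size f₁ + f₂ (valid-by-foldings).  Two kinds of foldings suffice:
-- restrictions (keep X, put every other vertex on a side given by a predicate)
-- and collapses (keep X, send a set M meeting X in one vertex m to m, put the
-- rest on the false side).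

open import Defs
open import Data.Bool using (Bool; true; false; not; _∨_; if_then_else_)
open import Data.Bool.Properties using (∨-identityʳ) renaming (_≟_ to _≟ᵇ_)
open import Data.Empty using (⊥; ⊥-elim)
open import Data.List using (map; _++_; length)
open import Data.List.Properties using (length-++; length-map)
open import Data.List.Membership.Propositional using (lose)
open import Data.List.Relation.Unary.Any using (Any; any?; satisfied)
import Data.List.Relation.Unary.Any as Any
open import Data.List.Relation.Unary.Any.Properties using (++⁺ˡ; ++⁺ʳ; map⁺)
open import Data.Nat using (_+_)
open import Data.Product using (_×_; _,_; ∃; ∃-syntax)
open import Data.Sum using (_⊎_; inj₁; inj₂)
open import Data.Sum.Properties using () renaming (≡-dec to ⊎-≡-dec)
open import Relation.Nullary using (¬_; Dec; yes; no; does)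
open import Relation.Nullary.Decidable using (map′; _×-dec_; dec-true)
open import Relation.Binary.PropositionalEquality
  using (_≡_; _≢_; refl; sym; trans; cong; cong₂; module ≡-Reasoning)
open import Axiom.UniquenessOfIdentityProofs using (module Decidable⇒UIP)

clash : ∀ {b} → b ≡ true → b ≡ false → ⊥
clash refl ()

∨-inl : ∀ {a} b → a ≡ true → a ∨ b ≡ true
∨-inl b refl = refl

∨-inr : ∀ a {b} → b ≡ true → a ∨ b ≡ true
∨-inr true  _ = refl
∨-inr false e = e

not-true : ∀ {b} → not b ≡ true → b ≡ false
not-true {false} _ = refl

not-false : ∀ {b} → not b ≡ false → b ≡ true
not-false {true} _ = refl

witness : ∀ {A : Set} (a? : Dec A) → does a? ≡ true → A
witness (yes a) _ = a

module _ (G : Graph) where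

  ≡ᵛ-refl : ∀ v → ≡ᵛ G v v ≡ true
  ≡ᵛ-refl v with _≟_ G v v
  ... | yes _  = refl
  ... | no v≢v = ⊥-elim (v≢v refl)

  ≡ᵛ-sound : ∀ {u v} → ≡ᵛ G u v ≡ true → u ≡ v
  ≡ᵛ-sound {u} {v} e with _≟_ G u v
  ... | yes u≡v = u≡v

  Meets : Subset (V G) → Subset (V G) → Set
  Meets A B = ∃[ v ] (v ∈ˢ A × v ∈ˢ B)

  exists? : {P : V G → Set} → (∀ v → Dec (P v)) → Dec (∃ P)
  exists? P? = map′ satisfied (λ (v , p) → lose (vertices-complete G v) p) (any? P? (vertices G))

  meets? : (A B : Subset (V G)) → Dec (Meets A B)
  meets? A B = exists? (λ v → (A v ≟ᵇ true) ×-dec (B v ≟ᵇ true))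

  outside-of : ∀ {K A} → ¬ Meets K A → ∀ w → w ∈ˢ K → A w ≡ false
  outside-of {A = A} ¬meet w Kw with A w in Aw
  ... | true  = ⊥-elim (¬meet (w , Kw , Aw))
  ... | false = refl

  meets-∨ˡ : ∀ {K} (A B : Subset (V G)) → Meets K A → Meets K (λ v → A v ∨ B v)
  meets-∨ˡ A B (v , Kv , Av) = v , Kv , ∨-inl {A v} (B v) Av

  meets-∨ʳ : ∀ {K} (A B : Subset (V G)) → Meets K B → Meets K (λ v → A v ∨ B v)
  meets-∨ʳ A B (v , Kv , Bv) = v , Kv , ∨-inr (A v) Bv

  clique-anticomplete : ∀ {K} (A B : Subset (V G)) → IsClique G K → Anticomplete G A B →
                        Disjoint G A B → Meets K A → Meets K B → ⊥
  clique-anticomplete A B k anti dis (u , Ku , Au) (v , Kv , Bv) =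
    clash (k u v Ku Kv u≢v) (anti u v Au Bv)
    where
    u≢v : u ≢ v
    u≢v refl = dis u Au Bv

  stable-complete : ∀ {S} (A B : Subset (V G)) → IsStable G S → Complete G A B →
                    Meets S A → Meets S B → ⊥
  stable-complete A B s com (u , Su , Au) (v , Sv , Bv) = clash (com u v Au Bv) (s u v Su Sv)

  Uniform : Subset (V G) → V G → Set
  Uniform M w = (∀ y → y ∈ˢ M → adj G w y ≡ true) ⊎ (∀ y → y ∈ˢ M → adj G w y ≡ false)

  clique-sees : ∀ {K M w} → IsClique G K → Meets K M → w ∈ˢ K → M w ≡ false → Uniform M w →
                ∀ y → y ∈ˢ M → adj G w y ≡ true
  clique-sees k _               _  _  (inj₁ complete) = complete
  clique-sees {w = w} k (u , Ku , Mu) Kw Mw (inj₂ anti) =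
    ⊥-elim (clash (k w u Kw Ku w≢u) (anti u Mu))
    where
    w≢u : w ≢ u
    w≢u refl = clash Mu Mw

  stable-misses : ∀ {S M w} → IsStable G S → Meets S M → w ∈ˢ S → Uniform M w →
                  ∀ y → y ∈ˢ M → adj G w y ≡ false
  stable-misses s (u , Su , Mu) Sw (inj₁ complete) = ⊥-elim (clash (complete u Mu) (s _ u Sw Su))
  stable-misses s _             _  (inj₂ anti)     = anti

  record Folding (X : Subset (V G)) : Set where
    field
      fold  : V G → V G ⊎ Bool
      lands : ∀ {v x} → fold v ≡ inj₁ x → x ∈ˢ X
  open Folding

  module _ {X : Subset (V G)} (F : Folding X) where

    read : Cut (G [ X ]) → (r : V G ⊎ Bool) → (∀ {x} → r ≡ inj₁ x → x ∈ˢ X) → Bool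
    read c (inj₁ x) h = c (x , h refl)
    read c (inj₂ b) _ = b

    read-on : ∀ c {b} r (h : ∀ {x} → r ≡ inj₁ x → x ∈ˢ X) →
              (∀ {x} (p : x ∈ˢ X) → r ≡ inj₁ x → c (x , p) ≡ b) →
              (∀ {b′} → r ≡ inj₂ b′ → b′ ≡ b) → read c r h ≡ b
    read-on c (inj₁ x)  h onX _   = onX (h refl) refl
    read-on c (inj₂ b′) _ _   onB = onB refl

    extend : Cut (G [ X ]) → Cut G
    extend c v = read c (fold F v) (lands F)

    hit? : (K : Subset (V G)) (x : V G) → Dec (∃[ u ] (u ∈ˢ K × fold F u ≡ inj₁ x))
    hit? K x = exists? (λ u → (K u ≟ᵇ true) ×-dec ⊎-≡-dec (_≟_ G) _≟ᵇ_ (fold F u) (inj₁ x))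

    image : Subset (V G) → Subset (V (G [ X ]))
    image K (x , _) = does (hit? K x)

    record Transfers (K S : Subset (V G)) : Set where
      field
        K-true  : ∀ {u b} → u ∈ˢ K → fold F u ≡ inj₂ b → b ≡ true
        S-false : ∀ {u b} → u ∈ˢ S → fold F u ≡ inj₂ b → b ≡ false
        clique  : ∀ {u v x y} → u ∈ˢ K → v ∈ˢ K → fold F u ≡ inj₁ x → fold F v ≡ inj₁ y →
                  x ≢ y → adj G x y ≡ true
        stable  : ∀ {u v x y} → u ∈ˢ S → v ∈ˢ S → fold F u ≡ inj₁ x → fold F v ≡ inj₁ y →
                  adj G x y ≡ false
        apart   : ∀ {u v x} → u ∈ˢ K → v ∈ˢ S → fold F u ≡ inj₁ x → fold F v ≡ inj₁ x → ⊥

    transfer : ∀ {K S} → Transfers K S → ∀ cs → IsCSSeparator (G [ X ]) cs →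
               Any (λ c → Separates G c K S) (map extend cs)
    transfer {K} {S} T cs sep =
      map⁺ (Any.map separates-through
                    (sep (image K) (image S) image-clique image-stable image-apart))
      where
      open Transfers T

      same-vertex : ∀ {x y} {p : x ∈ˢ X} {q : y ∈ˢ X} → x ≡ y → (x , p) ≡ (y , q)
      same-vertex refl = cong (_ ,_) (Decidable⇒UIP.≡-irrelevant _≟ᵇ_ _ _)

      image-clique : IsClique (G [ X ]) (image K)
      image-clique (x , _) (y , _) hx hy ne
        with (u , Ku , eu) ← witness (hit? K x) hx | (v , Kv , ev) ← witness (hit? K y) hy
        = clique Ku Kv eu ev (λ x≡y → ne (same-vertex x≡y))

      image-stable : IsStable (G [ X ]) (image S)
      image-stable (x , _) (y , _) hx hy
        with (u , Su , eu) ← witness (hit? S x) hx | (v , Sv , ev) ← witness (hit? S y) hy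
        = stable Su Sv eu ev

      image-apart : Disjoint (G [ X ]) (image K) (image S)
      image-apart (x , _) hx hy
        with (u , Ku , eu) ← witness (hit? K x) hx | (v , Sv , ev) ← witness (hit? S x) hy
        = apart Ku Sv eu ev

      separates-through : ∀ {c} → Separates (G [ X ]) c (image K) (image S) →
                          Separates G (extend c) K S
      separates-through {c} (onK , onS) =
        (λ v Kv → read-on c (fold F v) (lands F)
                    (λ p e → onK (_ , p) (dec-true (hit? K _) (v , Kv , e))) (K-true Kv)) ,
        (λ v Sv → read-on c (fold F v) (lands F)
                    (λ p e → onS (_ , p) (dec-true (hit? S _) (v , Sv , e))) (S-false Sv))

  valid-by-foldings : ∀ {X₁ X₂} (F₁ : Folding X₁) (F₂ : Folding X₂) →
    (∀ K S → IsClique G K → IsStable G S → Disjoint G K S → Transfers F₁ K S ⊎ Transfers F₂ K S) →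
    Valid G (G [ X₁ ]) (G [ X₂ ])
  valid-by-foldings F₁ F₂ choose f₁ f₂ (cs₁ , len₁ , sep₁) (cs₂ , len₂ , sep₂) =
    map (extend F₁) cs₁ ++ map (extend F₂) cs₂ , size , separator
    where
    open ≡-Reasoning
    size : length (map (extend F₁) cs₁ ++ map (extend F₂) cs₂) ≡ f₁ + f₂
    size = begin
      length (map (extend F₁) cs₁ ++ map (extend F₂) cs₂)
        ≡⟨ length-++ (map (extend F₁) cs₁) ⟩
      length (map (extend F₁) cs₁) + length (map (extend F₂) cs₂)
        ≡⟨ cong₂ _+_ (length-map (extend F₁) cs₁) (length-map (extend F₂) cs₂) ⟩
      length cs₁ + length cs₂
        ≡⟨ cong₂ _+_ len₁ len₂ ⟩
      f₁ + f₂ ∎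
    separator : IsCSSeparator G (map (extend F₁) cs₁ ++ map (extend F₂) cs₂)
    separator K S k s dis with choose K S k s dis
    ... | inj₁ T = ++⁺ˡ (transfer F₁ T cs₁ sep₁)
    ... | inj₂ T = ++⁺ʳ (map (extend F₁) cs₁) (transfer F₂ T cs₂ sep₂)

  keep : Subset (V G) → (V G → V G ⊎ Bool) → V G → V G ⊎ Bool
  keep X out v = if X v then inj₁ v else out v

  keep-view : ∀ X out {v r} → keep X out v ≡ r → (v ∈ˢ X × r ≡ inj₁ v) ⊎ (X v ≡ false × r ≡ out v)
  keep-view X out {v} e with X v
  ... | true  = inj₁ (refl , sym e)
  ... | false = inj₂ (refl , sym e)

  keep-lands : ∀ X out → (∀ {v x} → out v ≡ inj₁ x → x ∈ˢ X) →
               ∀ {v x} → keep X out v ≡ inj₁ x → x ∈ˢ X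
  keep-lands X out out-lands e with keep-view X out e
  ... | inj₁ (Xv , refl) = Xv
  ... | inj₂ (_ , e′)    = out-lands (sym e′)

  restriction : (X : Subset (V G)) → (V G → Bool) → Folding X
  restriction X d = record
    { fold  = keep X (λ v → inj₂ (d v))
    ; lands = keep-lands X (λ v → inj₂ (d v)) (λ ())
    }

  restriction-transfers : ∀ X d {K S} → IsClique G K → IsStable G S → Disjoint G K S →
    (∀ v → v ∈ˢ K → X v ≡ false → d v ≡ true) → (∀ v → v ∈ˢ S → X v ≡ false → d v ≡ false) →
    Transfers (restriction X d) K S
  restriction-transfers X d {K} {S} k s dis onK onS = record
    { K-true  = λ Ku e → constant onK Ku e
    ; S-false = λ Su e → constant onS Su e
    ; clique  = λ Ku Kv eu ev ne → clique′ Ku Kv (kept eu) (kept ev) ne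
    ; stable  = λ Su Sv eu ev → stable′ Su Sv (kept eu) (kept ev)
    ; apart   = λ Ku Sv eu ev → apart′ Ku Sv (kept eu) (kept ev)
    }
    where
    F = restriction X d
    out = λ v → inj₂ (d v)
    kept : ∀ {u x} → fold F u ≡ inj₁ x → u ≡ x
    kept e with keep-view X out e
    ... | inj₁ (_ , refl) = refl
    ... | inj₂ (_ , ())
    constant : ∀ {A : Subset (V G)} {b₀} → (∀ v → v ∈ˢ A → X v ≡ false → d v ≡ b₀) →
               ∀ {u b} → u ∈ˢ A → fold F u ≡ inj₂ b → b ≡ b₀
    constant onA {u} Au e with keep-view X out e
    ... | inj₁ (_ , ())
    ... | inj₂ (Xu , refl) = onA u Au Xu
    clique′ : ∀ {u v x y} → u ∈ˢ K → v ∈ˢ K → u ≡ x → v ≡ y → x ≢ y → adj G x y ≡ true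
    clique′ Ku Kv refl refl = k _ _ Ku Kv
    stable′ : ∀ {u v x y} → u ∈ˢ S → v ∈ˢ S → u ≡ x → v ≡ y → adj G x y ≡ false
    stable′ Su Sv refl refl = s _ _ Su Sv
    apart′ : ∀ {u v x} → u ∈ˢ K → v ∈ˢ S → u ≡ x → v ≡ x → ⊥
    apart′ Ku Sv refl refl = dis _ Ku Sv

  toward : Subset (V G) → V G → V G → V G ⊎ Bool
  toward M m v = if M v then inj₁ m else inj₂ false

  toward-inj₁ : ∀ M m {u x} → toward M m u ≡ inj₁ x → u ∈ˢ M × x ≡ m
  toward-inj₁ M m {u} e with M u
  ... | true with refl ← e = refl , refl

  toward-inj₂ : ∀ M m {u b} → toward M m u ≡ inj₂ b → M u ≡ false × b ≡ false
  toward-inj₂ M m {u} e with M u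
  ... | false with refl ← e = refl , refl

  collapse : (X M : Subset (V G)) (m : V G) → m ∈ˢ X → Folding X
  collapse X M m mX = record
    { fold  = keep X (toward M m)
    ; lands = keep-lands X (toward M m) toward-lands
    }
    where
    toward-lands : ∀ {v x} → toward M m v ≡ inj₁ x → x ∈ˢ X
    toward-lands e with (_ , refl) ← toward-inj₁ M m e = mX

  collapse-transfers : ∀ X M m (mM : m ∈ˢ M) (mX : m ∈ˢ X) {K S} →
    IsClique G K → IsStable G S → Disjoint G K S →
    (∀ w → w ∈ˢ X → w ∈ˢ M → w ≡ m) →
    (∀ w → w ∈ˢ X → M w ≡ false → Uniform M w) →
    (∀ w → w ∈ˢ K → X w ≡ false → w ∈ˢ M) →
    ¬ (Meets K M × Meets S M) →
    Transfers (collapse X M m mX) K S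
  collapse-transfers X M m mM mX {K} {S} k s dis only-m uniform avoid apart-in-M = record
    { K-true  = λ {u} Ku e → let (Mu , Xu , _) = dropped e in ⊥-elim (clash (avoid u Ku Xu) Mu)
    ; S-false = λ Su e → let (_ , _ , b≡false) = dropped e in b≡false
    ; clique  = λ Ku Kv eu ev → clique′ Ku Kv (folded eu) (folded ev)
    ; stable  = λ Su Sv eu ev → stable′ Su Sv (folded eu) (folded ev)
    ; apart   = λ Ku Sv eu ev → apart′ Ku Sv (folded eu) (folded ev)
    }
    where
    F = collapse X M m mX

    Folded : V G → V G → Set
    Folded u x = (u ∈ˢ M × x ≡ m) ⊎ (M u ≡ false × u ≡ x × x ∈ˢ X)

    folded : ∀ {u x} → fold F u ≡ inj₁ x → Folded u x
    folded {u} e with keep-view X (toward M m) e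
    ... | inj₂ (_ , e′) = inj₁ (toward-inj₁ M m (sym e′))
    ... | inj₁ (Xu , refl) with M u in Mu
    ...   | true  = inj₁ (refl , only-m u Xu Mu)
    ...   | false = inj₂ (refl , refl , Xu)

    dropped : ∀ {u b} → fold F u ≡ inj₂ b → M u ≡ false × X u ≡ false × b ≡ false
    dropped e with keep-view X (toward M m) e
    ... | inj₂ (Xu , e′) = let (Mu , b≡false) = toward-inj₂ M m (sym e′) in Mu , Xu , b≡false

    sees : ∀ {u w} → u ∈ˢ K → u ∈ˢ M → w ∈ˢ K → M w ≡ false → w ∈ˢ X → adj G w m ≡ true
    sees Ku Mu Kw Mw Xw = clique-sees k (_ , Ku , Mu) Kw Mw (uniform _ Xw Mw) m mM

    misses : ∀ {u w} → u ∈ˢ S → u ∈ˢ M → w ∈ˢ S → M w ≡ false → w ∈ˢ X → adj G w m ≡ false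
    misses Su Mu Sw Mw Xw = stable-misses s (_ , Su , Mu) Sw (uniform _ Xw Mw) m mM

    clique′ : ∀ {u v x y} → u ∈ˢ K → v ∈ˢ K → Folded u x → Folded v y → x ≢ y → adj G x y ≡ true
    clique′ _  _  (inj₁ (_ , refl))       (inj₁ (_ , refl))       ne = ⊥-elim (ne refl)
    clique′ Ku Kv (inj₁ (Mu , refl))      (inj₂ (Mv , refl , Xv)) _  =
      trans (adj-sym G m _) (sees Ku Mu Kv Mv Xv)
    clique′ Ku Kv (inj₂ (Mu , refl , Xu)) (inj₁ (Mv , refl))      _  = sees Kv Mv Ku Mu Xu
    clique′ Ku Kv (inj₂ (_ , refl , _))   (inj₂ (_ , refl , _))   ne = k _ _ Ku Kv ne

    stable′ : ∀ {u v x y} → u ∈ˢ S → v ∈ˢ S → Folded u x → Folded v y → adj G x y ≡ false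
    stable′ _  _  (inj₁ (_ , refl))       (inj₁ (_ , refl))       = adj-irrefl G m
    stable′ Su Sv (inj₁ (Mu , refl))      (inj₂ (Mv , refl , Xv)) =
      trans (adj-sym G m _) (misses Su Mu Sv Mv Xv)
    stable′ Su Sv (inj₂ (Mu , refl , Xu)) (inj₁ (Mv , refl))      = misses Sv Mv Su Mu Xu
    stable′ Su Sv (inj₂ (_ , refl , _))   (inj₂ (_ , refl , _))   = s _ _ Su Sv

    apart′ : ∀ {u v x} → u ∈ˢ K → v ∈ˢ S → Folded u x → Folded v x → ⊥
    apart′ Ku Sv (inj₁ (Mu , _))        (inj₁ (Mv , _))        =
      apart-in-M ((_ , Ku , Mu) , (_ , Sv , Mv))
    apart′ _  _  (inj₁ (_ , refl))      (inj₂ (Mm , refl , _)) = clash mM Mm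
    apart′ _  _  (inj₂ (Mm , refl , _)) (inj₁ (_ , refl))      = clash mM Mm
    apart′ Ku Sv (inj₂ (_ , refl , _))  (inj₂ (_ , refl , _))  = dis _ Ku Sv

  -- Component decomposition: a clique lies on one side of an anticomplete partition.
  component-valid : (A : Subset (V G)) → Anticomplete G A (λ v → not (A v)) →
                    Valid G (G [ A ]) (G [ (λ v → not (A v)) ])
  component-valid A anti =
    valid-by-foldings (restriction A (λ _ → false)) (restriction Ā (λ _ → false)) choose
    where
    Ā : Subset (V G)
    Ā v = not (A v)
    A-Ā : Disjoint G A Ā
    A-Ā v Av Āv = clash Av (not-true Āv)
    choose : ∀ K S → IsClique G K → IsStable G S → Disjoint G K S → _
    choose K S k s dis with meets? K Ā
    ... | yes K∩Ā = inj₂ (restriction-transfers Ā _ k s dis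
            (λ v Kv Āv → ⊥-elim (clique-anticomplete A Ā k anti A-Ā (v , Kv , not-false Āv) K∩Ā))
            (λ _ _ _ → refl))
    ... | no K∌Ā  = inj₁ (restriction-transfers A _ k s dis
            (λ v Kv Av → ⊥-elim (K∌Ā (v , Kv , cong not Av)))
            (λ _ _ _ → refl))

  -- Anticomponent decomposition: a stable set lies on one side of a complete partition.
  anticomponent-valid : (A : Subset (V G)) → Complete G A (λ v → not (A v)) →
                        Valid G (G [ A ]) (G [ (λ v → not (A v)) ])
  anticomponent-valid A com =
    valid-by-foldings (restriction A (λ _ → true)) (restriction Ā (λ _ → true)) choose
    where
    Ā : Subset (V G)
    Ā v = not (A v)
    choose : ∀ K S → IsClique G K → IsStable G S → Disjoint G K S → _
    choose K S k s dis with meets? S Ā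
    ... | yes S∩Ā = inj₂ (restriction-transfers Ā _ k s dis
            (λ _ _ _ → refl)
            (λ v Sv Āv → ⊥-elim (stable-complete A Ā s com (v , Sv , not-false Āv) S∩Ā)))
    ... | no S∌Ā  = inj₁ (restriction-transfers A _ k s dis
            (λ _ _ _ → refl)
            (λ v Sv Av → ⊥-elim (S∌Ā (v , Sv , cong not Av))))

  -- Cutset decomposition (A , C , B): a clique misses A or misses B.
  cutset-valid : (lab : V G → Part3) → Anticomplete G (λ v → isQ qA (lab v)) (λ v → isQ qB (lab v)) →
                 Valid G (G [ (λ v → not (isQ qB (lab v))) ]) (G [ (λ v → not (isQ qA (lab v))) ])
  cutset-valid lab anti =
    valid-by-foldings (restriction A∪C (λ _ → false)) (restriction C∪B (λ _ → false)) choose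
    where
    A B A∪C C∪B : Subset (V G)
    A v = isQ qA (lab v)
    B v = isQ qB (lab v)
    A∪C v = not (B v)
    C∪B v = not (A v)
    A-B : ∀ p → isQ qA p ≡ true → isQ qB p ≡ true → ⊥
    A-B qA _ ()
    A-B qC () _
    A-B qB () _
    choose : ∀ K S → IsClique G K → IsStable G S → Disjoint G K S → _
    choose K S k s dis with meets? K B
    ... | yes K∩B = inj₂ (restriction-transfers C∪B _ k s dis
            (λ v Kv Av → ⊥-elim (clique-anticomplete A B k anti (λ v → A-B (lab v))
                                   (v , Kv , not-false Av) K∩B))
            (λ _ _ _ → refl))
    ... | no K∌B  = inj₁ (restriction-transfers A∪C _ k s dis
            (λ v Kv Bv → ⊥-elim (K∌B (v , Kv , not-false Bv)))
            (λ _ _ _ → refl))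

  -- Neighbourhood decomposition at v: a clique through v lies in N[v].
  neighbourhood-valid : ∀ v → Valid G (G [ deleteV G v ]) (G [ N G v ])
  neighbourhood-valid v =
    valid-by-foldings (restriction (deleteV G v) (λ _ → false)) (restriction (N G v) (≡ᵛ G v)) choose
    where
    choose : ∀ K S → IsClique G K → IsStable G S → Disjoint G K S → _
    choose K S k s dis with K v in Kv
    ... | true  = inj₂ (restriction-transfers (N G v) (≡ᵛ G v) k s dis K-in-N[v] S-avoids-v)
      where
      K-in-N[v] : ∀ w → w ∈ˢ K → adj G v w ≡ false → ≡ᵛ G v w ≡ true
      K-in-N[v] w Kw v≁w with _≟_ G v w
      ... | yes _   = refl
      ... | no v≢w  = ⊥-elim (clash (k v w Kv Kw v≢w) v≁w)
      S-avoids-v : ∀ w → w ∈ˢ S → adj G v w ≡ false → ≡ᵛ G v w ≡ false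
      S-avoids-v w Sw _ with _≟_ G v w
      ... | yes refl = ⊥-elim (dis v Kv Sw)
      ... | no _     = refl
    ... | false = inj₁ (restriction-transfers (deleteV G v) _ k s dis K-avoids-v (λ _ _ _ → refl))
      where
      K-avoids-v : ∀ w → w ∈ˢ K → deleteV G v w ≡ false → false ≡ true
      K-avoids-v w Kw w≡v = ⊥-elim (clash Kw (subst-K (≡ᵛ-sound (not-false w≡v))))
        where
        subst-K : v ≡ w → K w ≡ false
        subst-K refl = Kv

  -- Antineighbourhood decomposition at v: a stable set through v avoids N(v).
  antineighbourhood-valid : ∀ v → Valid G (G [ deleteV G v ]) (G [ (λ w → not (N[_] G v w)) ])
  antineighbourhood-valid v =
    valid-by-foldings (restriction (deleteV G v) (λ _ → true)) (restriction far (adj G v)) choose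
    where
    far : Subset (V G)
    far w = not (N[_] G v w)
    choose : ∀ K S → IsClique G K → IsStable G S → Disjoint G K S → _
    choose K S k s dis with S v in Sv
    ... | true  = inj₂ (restriction-transfers far (adj G v) k s dis K-in-N (λ w Sw _ → s v w Sv Sw))
      where
      K-in-N : ∀ w → w ∈ˢ K → far w ≡ false → adj G v w ≡ true
      K-in-N w Kw near with _≟_ G v w | adj G v w
      ... | yes refl | _     = ⊥-elim (dis v Kw Sv)
      ... | no _     | true  = refl
      ... | no _     | false = ⊥-elim (clash refl near)
    ... | false = inj₁ (restriction-transfers (deleteV G v) _ k s dis (λ _ _ _ → refl) S-avoids-v)
      where
      S-avoids-v : ∀ w → w ∈ˢ S → deleteV G v w ≡ false → true ≡ false
      S-avoids-v w Sw w≡v = ⊥-elim (clash Sw (subst-S (≡ᵛ-sound (not-false w≡v))))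
        where
        subst-S : v ≡ w → S w ≡ false
        subst-S refl = Sv

  -- Module decomposition: if K and S both meet M, work in G [ M ] with every
  -- outside vertex on the side of its adjacency to m; otherwise collapse M onto m.
  module-valid : (M : Subset (V G)) → IsModule G M → (m : V G) → m ∈ˢ M →
                 Valid G (G [ M ]) (G [ (λ v → ≡ᵛ G m v ∨ not (M v)) ])
  module-valid M isMod m mM =
    valid-by-foldings (restriction M (λ w → adj G w m)) (collapse rest M m m∈rest) choose
    where
    rest : Subset (V G)
    rest v = ≡ᵛ G m v ∨ not (M v)

    m∈rest : m ∈ˢ rest
    m∈rest = ∨-inl {≡ᵛ G m m} _ (≡ᵛ-refl m)

    rest∩M : ∀ w → w ∈ˢ rest → w ∈ˢ M → w ≡ m
    rest∩M w in-rest Mw with _≟_ G m w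
    ... | yes m≡w = sym m≡w
    ... | no _    = ⊥-elim (clash Mw (not-true in-rest))

    outside-rest : ∀ w → rest w ≡ false → w ∈ˢ M
    outside-rest w out with _≟_ G m w
    ... | yes _ = ⊥-elim (clash refl out)
    ... | no _  = not-false out

    collapse-M : ∀ {K S} → IsClique G K → IsStable G S → Disjoint G K S →
                 ¬ (Meets K M × Meets S M) → Transfers (collapse rest M m m∈rest) K S
    collapse-M k s dis = collapse-transfers rest M m mM m∈rest k s dis rest∩M
                           (λ w _ Mw → isMod w Mw) (λ w _ → outside-rest w)

    choose : ∀ K S → IsClique G K → IsStable G S → Disjoint G K S → _
    choose K S k s dis with meets? K M | meets? S M
    ... | yes K∩M | yes S∩M = inj₁ (restriction-transfers M _ k s dis
            (λ w Kw Mw → clique-sees k K∩M Kw Mw (isMod w Mw) m mM)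
            (λ w Sw Mw → stable-misses s S∩M Sw (isMod w Mw) m mM))
    ... | no K∌M  | _       = inj₂ (collapse-M k s dis (λ (K∩M , _) → K∌M K∩M))
    ... | yes _   | no S∌M  = inj₂ (collapse-M k s dis (λ (_ , S∩M) → S∌M S∩M))

  -- Amalgam decomposition: side 1 collapses A₂ onto a₂ and puts B₂ on the false
  -- side, side 2 symmetrically; a pair goes to side 2 when K meets B₂ or K and
  -- S both meet A₂, and to side 1 otherwise.
  amalgam-valid : (lab : V G → Part) → IsAmalgam G lab → (a₁ a₂ : V G) →
    lab a₁ ≡ pA₁ → lab a₂ ≡ pA₂ →
    Valid G (G [ (λ v → isB₁ (lab v) ∨ isA₁ (lab v) ∨ isC (lab v) ∨ ≡ᵛ G a₂ v) ])
            (G [ (λ v → ≡ᵛ G a₁ v ∨ isC (lab v) ∨ isA₂ (lab v) ∨ isB₂ (lab v)) ])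
  amalgam-valid lab am a₁ a₂ la₁ la₂ =
    valid-by-foldings (collapse X₁ A₂ a₂ a₂∈X₁) (collapse X₂ A₁ a₁ a₁∈X₂) choose
    where
    open IsAmalgam am

    B₁ A₁ A₂ B₂ X₁ X₂ : Subset (V G)
    B₁ v = isB₁ (lab v)
    A₁ v = isA₁ (lab v)
    A₂ v = isA₂ (lab v)
    B₂ v = isB₂ (lab v)
    X₁ v = isB₁ (lab v) ∨ isA₁ (lab v) ∨ isC (lab v) ∨ ≡ᵛ G a₂ v
    X₂ v = ≡ᵛ G a₁ v ∨ isC (lab v) ∨ isA₂ (lab v) ∨ isB₂ (lab v)

    relabel : ∀ {u w p q} → lab u ≡ p → u ≡ w → lab w ≡ q → p ≡ q
    relabel lu refl lw = trans (sym lu) lw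

    a₂∈X₁ : a₂ ∈ˢ X₁
    a₂∈X₁ rewrite la₂ = ≡ᵛ-refl a₂

    a₁∈X₂ : a₁ ∈ˢ X₂
    a₁∈X₂ = ∨-inl {≡ᵛ G a₁ a₁} _ (≡ᵛ-refl a₁)

    X₁∩A₂ : ∀ w → w ∈ˢ X₁ → w ∈ˢ A₂ → w ≡ a₂
    X₁∩A₂ w with lab w
    ... | pA₂ = λ Xw _ → sym (≡ᵛ-sound Xw)
    ... | pB₁ = λ _ ()
    ... | pA₁ = λ _ ()
    ... | pC  = λ _ ()
    ... | pB₂ = λ _ ()

    uniform₁ : ∀ w → w ∈ˢ X₁ → A₂ w ≡ false → Uniform A₂ w
    uniform₁ w with lab w in lw
    ... | pB₁ = λ _ _ → inj₂ (λ y Ay → B₁-anti w y (cong isB₁ lw) (∨-inl {A₂ y} _ Ay))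
    ... | pA₁ = λ _ _ → inj₁ (λ y Ay → A₁-A₂ w y (cong isA₁ lw) Ay)
    ... | pC  = λ _ _ → inj₁ (λ y Ay → C-A w y (cong isC lw) (∨-inr (A₁ y) Ay))
    ... | pA₂ = λ _ ()
    ... | pB₂ = λ Xw _ → ⊥-elim (A₂≢B₂ (relabel la₂ (≡ᵛ-sound Xw) lw))
      where A₂≢B₂ : pA₂ ≢ pB₂
            A₂≢B₂ ()

    avoid₁ : ∀ {K} → (∀ w → w ∈ˢ K → B₂ w ≡ false) → ∀ w → w ∈ˢ K → X₁ w ≡ false → w ∈ˢ A₂
    avoid₁ noB₂ w Kw with lab w in lw
    ... | pA₂ = λ _ → refl
    ... | pB₂ = λ _ → ⊥-elim (clash (cong isB₂ lw) (noB₂ w Kw))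
    ... | pB₁ = λ ()
    ... | pA₁ = λ ()
    ... | pC  = λ ()

    X₂∩A₁ : ∀ w → w ∈ˢ X₂ → w ∈ˢ A₁ → w ≡ a₁
    X₂∩A₁ w with lab w
    ... | pA₁ = λ Xw _ → sym (≡ᵛ-sound (trans (sym (∨-identityʳ _)) Xw))
    ... | pB₁ = λ _ ()
    ... | pC  = λ _ ()
    ... | pA₂ = λ _ ()
    ... | pB₂ = λ _ ()

    uniform₂ : ∀ w → w ∈ˢ X₂ → A₁ w ≡ false → Uniform A₁ w
    uniform₂ w with lab w in lw
    ... | pB₂ = λ _ _ → inj₂ (λ y Ay → B₂-anti w y (cong isB₂ lw) (∨-inl {A₁ y} _ Ay))
    ... | pA₂ = λ _ _ → inj₁ (λ y Ay → trans (adj-sym G w y) (A₁-A₂ y w Ay (cong isA₂ lw)))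
    ... | pC  = λ _ _ → inj₁ (λ y Ay → C-A w y (cong isC lw) (∨-inl {A₁ y} _ Ay))
    ... | pA₁ = λ _ ()
    ... | pB₁ = λ Xw _ → ⊥-elim (A₁≢B₁ (relabel la₁ (≡ᵛ-sound (trans (sym (∨-identityʳ _)) Xw)) lw))
      where A₁≢B₁ : pA₁ ≢ pB₁
            A₁≢B₁ ()

    avoid₂ : ∀ {K} → (∀ w → w ∈ˢ K → B₁ w ≡ false) → ∀ w → w ∈ˢ K → X₂ w ≡ false → w ∈ˢ A₁
    avoid₂ noB₁ w Kw with lab w in lw
    ... | pA₁ = λ _ → refl
    ... | pB₁ = λ _ → ⊥-elim (clash (cong isB₁ lw) (noB₁ w Kw))
    ... | pC  = λ out → ⊥-elim (clash (∨-inr (≡ᵛ G a₁ w) refl) out)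
    ... | pA₂ = λ out → ⊥-elim (clash (∨-inr (≡ᵛ G a₁ w) refl) out)
    ... | pB₂ = λ out → ⊥-elim (clash (∨-inr (≡ᵛ G a₁ w) refl) out)

    side₁ : ∀ {K S} → IsClique G K → IsStable G S → Disjoint G K S →
            (∀ w → w ∈ˢ K → B₂ w ≡ false) → ¬ (Meets K A₂ × Meets S A₂) →
            Transfers (collapse X₁ A₂ a₂ a₂∈X₁) K S
    side₁ k s dis noB₂ =
      collapse-transfers X₁ A₂ a₂ (cong isA₂ la₂) a₂∈X₁ k s dis X₁∩A₂ uniform₁ (avoid₁ noB₂)

    side₂ : ∀ {K S} → IsClique G K → IsStable G S → Disjoint G K S →
            (∀ w → w ∈ˢ K → B₁ w ≡ false) → ¬ (Meets K A₁ × Meets S A₁) →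
            Transfers (collapse X₂ A₁ a₁ a₁∈X₂) K S
    side₂ k s dis noB₁ =
      collapse-transfers X₂ A₁ a₁ (cong isA₁ la₁) a₁∈X₂ k s dis X₂∩A₁ uniform₂ (avoid₂ noB₁)

    B₁-apart : Disjoint G B₁ (λ v → A₂ v ∨ B₂ v)
    B₁-apart v with lab v
    ... | pB₁ = λ _ ()
    ... | pA₁ = λ ()
    ... | pC  = λ ()
    ... | pA₂ = λ ()
    ... | pB₂ = λ ()

    B₂-apart : Disjoint G B₂ (λ v → A₁ v ∨ B₁ v)
    B₂-apart v with lab v
    ... | pB₂ = λ _ ()
    ... | pB₁ = λ ()
    ... | pA₁ = λ ()
    ... | pC  = λ ()
    ... | pA₂ = λ ()

    no-B₁ : ∀ {K} → IsClique G K → Meets K (λ v → A₂ v ∨ B₂ v) → ∀ w → w ∈ˢ K → B₁ w ≡ false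
    no-B₁ k meet = outside-of (λ K∩B₁ → clique-anticomplete B₁ _ k B₁-anti B₁-apart K∩B₁ meet)

    choose : ∀ K S → IsClique G K → IsStable G S → Disjoint G K S → _
    choose K S k s dis with meets? K B₂ | meets? K A₂ | meets? S A₂
    ... | yes K∩B₂ | _        | _        = inj₂ (side₂ k s dis (no-B₁ k (meets-∨ʳ A₂ B₂ K∩B₂))
            (λ (K∩A₁ , _) → clique-anticomplete B₂ _ k B₂-anti B₂-apart K∩B₂ (meets-∨ˡ A₁ B₁ K∩A₁)))
    ... | no _     | yes K∩A₂ | yes S∩A₂ = inj₂ (side₂ k s dis (no-B₁ k (meets-∨ˡ A₂ B₂ K∩A₂))
            (λ (_ , S∩A₁) → stable-complete A₁ A₂ s A₁-A₂ S∩A₁ S∩A₂))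
    ... | no K∌B₂  | yes _    | no S∌A₂  = inj₁ (side₁ k s dis (outside-of K∌B₂)
            (λ (_ , S∩A₂) → S∌A₂ S∩A₂))
    ... | no K∌B₂  | no K∌A₂  | _        = inj₁ (side₁ k s dis (outside-of K∌B₂)
            (λ (K∩A₂ , _) → K∌A₂ K∩A₂))

lemma3 : (G : Graph) (d : Decomposition G) → Valid G (dec₁ G d) (dec₂ G d)
lemma3 G (component A _ _ anti)        = component-valid G A anti
lemma3 G (anticomponent A _ _ com)     = anticomponent-valid G A com
lemma3 G (cutset lab _ _ anti)         = cutset-valid G lab anti
lemma3 G (module-dec M isMod _ m mM)   = module-valid G M isMod m mM
lemma3 G (nbhd _ v _)                  = neighbourhood-valid G v
lemma3 G (antinbhd _ v _)              = antineighbourhood-valid G v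
lemma3 G (amalgam lab am a₁ a₂ la₁ la₂) = amalgam-valid G lab am a₁ a₂ la₁ la₂
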